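{- Let $\Sigma$ be a signature, $X$ a countable set of variables, and $\phi,\psi$ two endomorphisms of the $\Sigma$-algebra $Ter^\infty(\Sigma,X)$ which coincide on $X$. Then $\phi=\psi$.
   Context: $Ter^\infty(\Sigma,X)$ is the set of finite and infinite terms over $\Sigma$ and $X$ (trees given by a nonempty prefix-closed set of positions, with $pj$ present and $i<j$ implying $pi$ present, labelled by $\Sigma\cup X$ respecting arities). It is a $\Sigma$-algebra with $f/n\in\Sigma$ interpreted as $(t_1,\dots,t_n)\mapsto f(t_1,\dots,t_n)$. An endomorphism is a map $h$ with $h(f(t_1,\dots,t_n))=f(h(t_1),\dots,h(t_n))$. -}

module Defs where

open import Data.Nat using (ℕ; _<_; _<?_)
open import Data.Nat.Properties using (<-irrefl)
open import Data.Fin using (Fin; fromℕ<; toℕ)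
open import Data.List using (List; []; _∷_; _∷ʳ_)
open import Data.Maybe using (Maybe; just; nothing; Is-just)
open import Data.Maybe.Relation.Unary.Any using (just)
open import Data.Sum using (_⊎_; inj₁; inj₂)
open import Data.Unit using (tt)
open import Data.Empty using (⊥-elim)
open import Function using (_∘_; _⇔_; mk⇔)
open import Relation.Nullary using (yes; no)
open import Relation.Binary.PropositionalEquality using (_≡_; refl; subst)

record Signature : Set₁ where
  field
    Sym : Set
    ar  : Sym → ℕ
open Signature public

-- Positions: finite sequences of argument indices (0-based).
Pos : Set
Pos = List ℕ

Label : Signature → Set → Set
Label S X = Sym S ⊎ X

-- A finite or infinite term over S and X, given (as in the paper) by its
-- set of positions together with the labelling: lab p ≡ nothing means
-- that p is not a position of the term.
record Ter (S : Signature) (X : Set) : Set where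
  field
    lab     : Pos → Maybe (Label S X)
    root    : Is-just (lab [])
    closed  : ∀ p i → Is-just (lab (p ∷ʳ i)) → Is-just (lab p)
    -- a position labelled f/n has exactly the children 0 … n-1
    -- (this also gives: p j present and i < j implies p i present)
    arity   : ∀ p f → lab p ≡ just (inj₁ f) → ∀ i →
              Is-just (lab (p ∷ʳ i)) ⇔ (i < ar S f)
    varLeaf : ∀ p x → lab p ≡ just (inj₂ x) → ∀ i → lab (p ∷ʳ i) ≡ nothing
open Ter public

infix 4 _≈_
_≈_ : ∀ {S X} → Ter S X → Ter S X → Set
t ≈ u = ∀ p → lab t p ≡ lab u p

var : ∀ {S X} → X → Ter S X
var {S} {X} x = record
  { lab = l ; root = just tt ; closed = c ; arity = a ; varLeaf = v }
  where
  l : Pos → Maybe (Label S X)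
  l []      = just (inj₂ x)
  l (_ ∷ _) = nothing
  c : ∀ p i → Is-just (l (p ∷ʳ i)) → Is-just (l p)
  c [] i ()
  c (_ ∷ p) i ()
  a : ∀ p f → l p ≡ just (inj₁ f) → ∀ i → Is-just (l (p ∷ʳ i)) ⇔ (i < ar S f)
  a [] f ()
  a (_ ∷ _) f ()
  v : ∀ p y → l p ≡ just (inj₂ y) → ∀ i → l (p ∷ʳ i) ≡ nothing
  v [] y e i = refl
  v (_ ∷ _) y () i

app : ∀ {S X} (f : Sym S) → (Fin (ar S f) → Ter S X) → Ter S X
app {S} {X} f ts = record
  { lab = l ; root = just tt ; closed = c ; arity = a ; varLeaf = v }
  where
  l : Pos → Maybe (Label S X)
  l []      = just (inj₁ f)
  l (i ∷ p) with i <? ar S f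
  ... | yes lt = lab (ts (fromℕ< lt)) p
  ... | no _   = nothing
  c : ∀ p i → Is-just (l (p ∷ʳ i)) → Is-just (l p)
  c [] i _ = just tt
  c (j ∷ p) i h with j <? ar S f
  ... | yes lt = closed (ts (fromℕ< lt)) p i h
  ... | no _   = h
  a : ∀ p g → l p ≡ just (inj₁ g) → ∀ i → Is-just (l (p ∷ʳ i)) ⇔ (i < ar S g)
  a [] .f refl i with i <? ar S f
  ... | yes lt = mk⇔ (λ _ → lt) (λ _ → root (ts (fromℕ< lt)))
  ... | no nlt = mk⇔ (λ ()) (λ lt → ⊥-elim (nlt lt))
  a (j ∷ p) g e i with j <? ar S f
  ... | yes lt = arity (ts (fromℕ< lt)) p g e i
  a (j ∷ p) g () i | no _
  v : ∀ p y → l p ≡ just (inj₂ y) → ∀ i → l (p ∷ʳ i) ≡ nothing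
  v [] y () i
  v (j ∷ p) y e i with j <? ar S f
  ... | yes lt = varLeaf (ts (fromℕ< lt)) p y e i
  v (j ∷ p) y () i | no _

-- Endomorphisms of the Σ-algebra Ter^∞(Σ,X).  Since terms are identified
-- up to _≈_ (same positions and labels), a map must respect _≈_.
record Endo (S : Signature) (X : Set) : Set where
  field
    h    : Ter S X → Ter S X
    cong : ∀ {t u} → t ≈ u → h t ≈ h u
    hom  : ∀ f (ts : Fin (ar S f) → Ter S X) → h (app f ts) ≈ app f (h ∘ ts)
open Endo public

-- The labels of h t at depth n + 1 are those of h applied to the immediate
-- subterms of t at depth n: decompose t as var x or f(t₁,…,tₙ) up to ≈ and
-- push h through it.  Hence two endomorphisms agreeing on variables agree at
-- every position, by induction on the position.
module Submission where

open import Defs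
open import Data.Nat using (ℕ; _<?_)
open import Data.Fin using (Fin; fromℕ<; toℕ)
open import Data.Fin.Properties using (toℕ-fromℕ<; toℕ<n)
open import Data.List using ([]; _∷_; _∷ʳ_; _++_)
open import Data.List.Properties using (++-assoc; ++-identityʳ)
open import Data.Maybe using (just; nothing; Is-just)
open import Data.Maybe.Relation.Unary.Any using (just)
open import Data.Product using (∃; ∃₂; _,_)
open import Data.Sum using (_⊎_; inj₁; inj₂)
open import Data.Unit using (tt)
open import Data.Empty using (⊥-elim)
open import Function using (_∘_; _↣_)
open import Function.Bundles using (Equivalence)
open import Relation.Nullary using (yes; no)
open import Relation.Binary.PropositionalEquality as ≡
  using (_≡_; refl; sym; subst; module ≡-Reasoning)

module _ {S : Signature} {X : Set} where

  isJust-prefix : (t : Ter S X) (q r : Pos) →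
                  Is-just (lab t (q ++ r)) → Is-just (lab t q)
  isJust-prefix t q []      h = subst (Is-just ∘ lab t) (++-identityʳ q) h
  isJust-prefix t q (a ∷ r) h = closed t q a (isJust-prefix t (q ∷ʳ a) r
    (subst (Is-just ∘ lab t) (sym (++-assoc q (a ∷ []) r)) h))

  absent-child⇒absent-subtree : (t : Ter S X) (i : ℕ) (p : Pos) →
                                lab t (i ∷ []) ≡ nothing → lab t (i ∷ p) ≡ nothing
  absent-child⇒absent-subtree t i p absent with lab t (i ∷ p) in present
  ... | nothing = refl
  ... | just _ with subst Is-just absent
                  (isJust-prefix t (i ∷ []) p (subst Is-just (sym present) (just tt)))
  ... | ()

  var-root⇒≈var : (t : Ter S X) {x : X} → lab t [] ≡ just (inj₂ x) → t ≈ var x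
  var-root⇒≈var t e []      = e
  var-root⇒≈var t e (i ∷ p) = absent-child⇒absent-subtree t i p (varLeaf t [] _ e i)

  subterm : (t : Ter S X) {f : Sym S} → lab t [] ≡ just (inj₁ f) →
            Fin (ar S f) → Ter S X
  subterm t {f} e k = record
    { lab     = λ p → lab t (toℕ k ∷ p)
    ; root    = Equivalence.from (arity t [] f e (toℕ k)) (toℕ<n k)
    ; closed  = λ p → closed t (toℕ k ∷ p)
    ; arity   = λ p → arity t (toℕ k ∷ p)
    ; varLeaf = λ p → varLeaf t (toℕ k ∷ p)
    }

  sym-root⇒≈app : (t : Ter S X) {f : Sym S} (e : lab t [] ≡ just (inj₁ f)) →
                  t ≈ app f (subterm t e)
  sym-root⇒≈app t e [] = e
  sym-root⇒≈app t {f} e (i ∷ p) with i <? ar S f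
  ... | yes i<n = ≡.cong (λ j → lab t (j ∷ p)) (sym (toℕ-fromℕ< i<n))
  ... | no i≮n with lab t (i ∷ []) in child
  ...   | nothing = absent-child⇒absent-subtree t i p child
  ...   | just _  = ⊥-elim (i≮n (Equivalence.to (arity t [] f e i)
                                   (subst Is-just (sym child) (just tt))))

  ≈var⊎≈app : (t : Ter S X) →
              (∃ λ x → t ≈ var x) ⊎ (∃₂ λ f (ts : Fin (ar S f) → Ter S X) → t ≈ app f ts)
  ≈var⊎≈app t with lab t [] in e | root t
  ... | just (inj₂ x) | _ = inj₁ (x , var-root⇒≈var t e)
  ... | just (inj₁ f) | _ = inj₂ (f , subterm t e , sym-root⇒≈app t e)

  app-lab-∷ : (f : Sym S) (us vs : Fin (ar S f) → Ter S X) (i : ℕ) (p : Pos) →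
              (∀ k → lab (us k) p ≡ lab (vs k) p) →
              lab (app f us) (i ∷ p) ≡ lab (app f vs) (i ∷ p)
  app-lab-∷ f us vs i p us≡vs with i <? ar S f
  ... | yes i<n = us≡vs (fromℕ< i<n)
  ... | no _    = refl

  Endo-agree-at : (φ ψ : Endo S X) → (∀ x → h φ (var x) ≈ h ψ (var x)) →
                  ∀ p t → lab (h φ t) p ≡ lab (h ψ t) p
  Endo-agree-at φ ψ φ≈ψ p t with ≈var⊎≈app t
  ... | inj₁ (x , t≈x) = begin
    lab (h φ t) p        ≡⟨ Endo.cong φ t≈x p ⟩
    lab (h φ (var x)) p  ≡⟨ φ≈ψ x p ⟩
    lab (h ψ (var x)) p  ≡⟨ Endo.cong ψ t≈x p ⟨
    lab (h ψ t) p        ∎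
    where open ≡-Reasoning
  ... | inj₂ (f , ts , t≈fts) = begin
    lab (h φ t) p                   ≡⟨ Endo.cong φ t≈fts p ⟩
    lab (h φ (app f ts)) p          ≡⟨ hom φ f ts p ⟩
    lab (app f (h φ ∘ ts)) p        ≡⟨ agree-below p ⟩
    lab (app f (h ψ ∘ ts)) p        ≡⟨ hom ψ f ts p ⟨
    lab (h ψ (app f ts)) p          ≡⟨ Endo.cong ψ t≈fts p ⟨
    lab (h ψ t) p                   ∎
    where
    open ≡-Reasoning
    agree-below : ∀ p → lab (app f (h φ ∘ ts)) p ≡ lab (app f (h ψ ∘ ts)) p
    agree-below []      = refl
    agree-below (i ∷ q) = app-lab-∷ f (h φ ∘ ts) (h ψ ∘ ts) i q
                            (λ k → Endo-agree-at φ ψ φ≈ψ q (ts k))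

mainTheorem6 : (S : Signature) (X : Set) → X ↣ ℕ →
               (φ ψ : Endo S X) →
               ((x : X) → h φ (var x) ≈ h ψ (var x)) →
               (t : Ter S X) → h φ t ≈ h ψ t
mainTheorem6 S X _ φ ψ φ≈ψ t p = Endo-agree-at φ ψ φ≈ψ p t
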